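{- $\gamma_{MB}(P_3 \square P_3) = \gamma'_{MB}(P_3 \square P_3) = 4$.
   Context: The Maker-Breaker domination game on a finite graph $G$ is played by Dominator and Staller, who alternately claim a previously unplayed vertex of $G$. Dominator wins as soon as his claimed vertices form a dominating set of $G$; Staller wins if she claims all vertices of some closed neighborhood $N_G[v]$ (so that Dominator can never dominate). The D-game is the game where Dominator moves first, the S-game where Staller moves first. $\gamma_{MB}(G)$ (resp. $\gamma'_{MB}(G)$) is the minimum number of moves Dominator needs to win the D-game (resp. S-game) when both players play optimally (Dominator trying to win as fast as possible, Staller trying to delay this), and is $\infty$ if Dominator has no winning strategy in that game. $P_k$ is the path on $k$ vertices and $\square$ denotes the Cartesian product of graphs. -}

module Defs where

open import Data.Bool using (Bool; true; false; if_then_else_; _∨_; _∧_)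
open import Data.Nat using (ℕ; zero; suc; _<_; _+_)
open import Data.Nat.Base using () renaming (_≡ᵇ_ to _==_)
open import Data.Fin using (Fin; toℕ)
open import Data.Fin.Properties using () renaming (_≟_ to _≟F_)
open import Data.Product using (Σ; ∃; _×_; _,_)
open import Data.Product.Properties using (≡-dec)
open import Data.Sum using (_⊎_)
open import Relation.Nullary using (¬_; does)
open import Relation.Binary using (DecidableEquality)
open import Relation.Binary.PropositionalEquality using (_≡_)

record Graph : Set₁ where
  field
    V    : Set
    _≟_  : DecidableEquality V
    adj  : V → V → Bool

P : ℕ → Graph
P k = record
  { V   = Fin k
  ; _≟_ = _≟F_
  ; adj = λ i j → ((toℕ i + 1) == toℕ j) ∨ ((toℕ j + 1) == toℕ i) }

_□_ : Graph → Graph → Graph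
G □ H = record
  { V   = G.V × H.V
  ; _≟_ = ≡-dec G._≟_ H._≟_
  ; adj = λ { (a , b) (c , d) →
        (does (a G.≟ c) ∧ H.adj b d) ∨ (does (b H.≟ d) ∧ G.adj a c) } }
  where
    module G = Graph G
    module H = Graph H

module Game (G : Graph) where
  open Graph G

  -- sets of claimed vertices, as characteristic functions
  VSet : Set
  VSet = V → Bool

  ∅ : VSet
  ∅ _ = false

  _＋_ : VSet → V → VSet
  (A ＋ v) u = if does (u ≟ v) then true else A u

  InClosedNbhd : V → V → Set
  InClosedNbhd u v = (u ≡ v) ⊎ (adj v u ≡ true)

  Dominating : VSet → Set
  Dominating D = ∀ v → ∃ λ u → (D u ≡ true) × InClosedNbhd u v

  StallerWon : VSet → Set
  StallerWon S = ∃ λ v → ∀ u → InClosedNbhd u v → S u ≡ true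

  Unplayed : VSet → VSet → V → Set
  Unplayed D S v = (D v ≡ false) × (S v ≡ false)

  -- WinD k D S : in position (D, S) with Dominator to move, Dominator can
  -- force a win (a dominating set) using at most k further moves of his.
  -- WinS k D S : the same with Staller to move.
  WinD : ℕ → VSet → VSet → Set
  WinS : ℕ → VSet → VSet → Set
  WinD zero    D S = Dominating D
  WinD (suc k) D S = Dominating D
                   ⊎ ((¬ StallerWon S) × ∃ λ v → Unplayed D S v × WinS k (D ＋ v) S)
  WinS k D S = Dominating D
             ⊎ ((¬ StallerWon S) × (∀ w → Unplayed D S w → WinD k D (S ＋ w)))

IsγMB : Graph → ℕ → Set
IsγMB G k = WinD k ∅ ∅ × (∀ j → j < k → ¬ WinD j ∅ ∅)
  where open Game G

IsγMB' : Graph → ℕ → Set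
IsγMB' G k = WinS k ∅ ∅ × (∀ j → j < k → ¬ WinS j ∅ ∅)
  where open Game G

{-# OPTIONS --safe #-}
module Submission where

-- Giving Dominator a larger move budget can only help him, so each equality splits into a
-- win within 4 moves and no win within 3.  On the nine vertices of P₃ □ P₃ these four
-- statements concern a finite game tree; they are settled by a Boolean evaluation of the game
-- that is proved to reflect WinD and WinS on every finite graph.

open import Defs
open import Data.Bool using (Bool; T; true; false; if_then_else_; _∧_; _∨_; not) renaming (_≟_ to _≟ᵇ_)
open import Data.Bool.ListAction using (all; any)
open import Data.Fin using (Fin; zero; suc; toℕ)
open import Data.List using (List; []; _∷_; map; _++_; allFin; cartesianProduct)
open import Data.List.Membership.Propositional using (_∈_; find; lose)
open import Data.List.Membership.Propositional.Properties using (∈-allFin; ∈-cartesianProduct⁺)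
import Data.List.Relation.Unary.All as All
open import Data.List.Relation.Unary.All.Properties using (all⁺; all⁻)
import Data.List.Relation.Unary.Any as Any
open import Data.List.Relation.Unary.Any.Properties using (any⁺; any⁻)
open import Data.Nat using (ℕ; zero; suc; _≡ᵇ_; _≤′_; ≤′-refl; ≤′-step; s≤s⁻¹)
open import Data.Nat.Properties using (≤⇒≤′)
open import Data.Product using (_×_; _,_; ∃)
open import Data.Sum using (inj₁; inj₂)
open import Function using (_∘_; _⇔_; mk⇔; Equivalence)
open import Relation.Binary.PropositionalEquality using (_≡_; _≗_; refl; sym; trans; cong)
open import Relation.Nullary using (Dec; _because_; does; proof; ¬_; _×-dec_; _⊎-dec_; _→-dec_; map′)
open import Relation.Nullary.Reflects using (Reflects; ofʸ; ofⁿ; fromEquivalence; ¬-reflects; _×-reflects_; _⊎-reflects_; _→-reflects_)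
open import Relation.Nullary.Decidable using (from-yes; from-no)
open import Relation.Unary using (Decidable)

reflects-⇔ : ∀ {A B : Set} {b} → A ⇔ B → Reflects A b → Reflects B b
reflects-⇔ A⇔B (ofʸ a)  = ofʸ (Equivalence.to A⇔B a)
reflects-⇔ A⇔B (ofⁿ ¬a) = ofⁿ (¬a ∘ Equivalence.from A⇔B)

reflects-sound : ∀ {A : Set} {b} → Reflects A b → T b → A
reflects-sound (ofʸ a) _ = a

reflects-complete : ∀ {A : Set} {b} → Reflects A b → A → T b
reflects-complete (ofʸ _)  _ = _
reflects-complete (ofⁿ ¬a) a = ¬a a

module Search {A : Set} (xs : List A) (∈-xs : ∀ x → x ∈ xs) where

  all-reflects : {P : A → Set} {p : A → Bool} →
                 (∀ x → Reflects (P x) (p x)) → Reflects (∀ x → P x) (all p xs)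
  all-reflects {p = p} r = fromEquivalence
    (λ t x → reflects-sound (r x) (All.lookup (all⁺ p xs t) (∈-xs x)))
    (λ all → all⁻ p {xs} (All.tabulate λ {x} _ → reflects-complete (r x) (all x)))

  any-reflects : {P : A → Set} {p : A → Bool} →
                 (∀ x → Reflects (P x) (p x)) → Reflects (∃ P) (any p xs)
  any-reflects {p = p} r = fromEquivalence
    (λ t → let x , _ , px = find (any⁻ p xs t) in x , reflects-sound (r x) px)
    (λ (x , Px) → any⁺ p (lose (∈-xs x) (reflects-complete (r x) Px)))

  all? : {P : A → Set} → Decidable P → Dec (∀ x → P x)
  all? P? = all (does ∘ P?) xs because all-reflects (proof ∘ P?)

  any? : {P : A → Set} → Decidable P → Dec (∃ P)
  any? P? = any (does ∘ P?) xs because any-reflects (proof ∘ P?)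

module MakerBreaker (G : Graph) where
  open Graph G
  open Game G public

  ＋-cong : ∀ {A B} v → A ≗ B → A ＋ v ≗ B ＋ v
  ＋-cong v A≗B u = cong (if does (u ≟ v) then true else_) (A≗B u)

  Dominating-resp : ∀ {D D′} → D ≗ D′ → Dominating D → Dominating D′
  Dominating-resp D≗D′ dom v = let u , Du , u~v = dom v in u , trans (sym (D≗D′ u)) Du , u~v

  StallerWon-resp : ∀ {S S′} → S ≗ S′ → StallerWon S → StallerWon S′
  StallerWon-resp S≗S′ (v , claimed) = v , λ u u~v → trans (sym (S≗S′ u)) (claimed u u~v)

  Unplayed-resp : ∀ {D D′ S S′ v} → D ≗ D′ → S ≗ S′ → Unplayed D S v → Unplayed D′ S′ v
  Unplayed-resp {v = v} D≗D′ S≗S′ (Dv , Sv) = trans (sym (D≗D′ v)) Dv , trans (sym (S≗S′ v)) Sv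

  WinD-resp : ∀ k {D D′ S S′} → D ≗ D′ → S ≗ S′ → WinD k D S → WinD k D′ S′
  WinS-resp : ∀ k {D D′ S S′} → D ≗ D′ → S ≗ S′ → WinS k D S → WinS k D′ S′
  WinD-resp zero    D≗ S≗ dom        = Dominating-resp D≗ dom
  WinD-resp (suc k) D≗ S≗ (inj₁ dom) = inj₁ (Dominating-resp D≗ dom)
  WinD-resp (suc k) D≗ S≗ (inj₂ (¬won , v , unplayed , win)) =
    inj₂ ( ¬won ∘ StallerWon-resp (sym ∘ S≗) , v , Unplayed-resp D≗ S≗ unplayed
         , WinS-resp k (＋-cong v D≗) S≗ win)
  WinS-resp k D≗ S≗ (inj₁ dom) = inj₁ (Dominating-resp D≗ dom)
  WinS-resp k D≗ S≗ (inj₂ (¬won , win)) =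
    inj₂ ( ¬won ∘ StallerWon-resp (sym ∘ S≗)
         , λ w unplayed → WinD-resp k D≗ (＋-cong w S≗)
                            (win w (Unplayed-resp (sym ∘ D≗) (sym ∘ S≗) unplayed)))

  WinD-⇔ : ∀ k {D D′ S S′} → D ≗ D′ → S ≗ S′ → WinD k D S ⇔ WinD k D′ S′
  WinD-⇔ k D≗ S≗ = mk⇔ (WinD-resp k D≗ S≗) (WinD-resp k (sym ∘ D≗) (sym ∘ S≗))

  WinS-⇔ : ∀ k {D D′ S S′} → D ≗ D′ → S ≗ S′ → WinS k D S ⇔ WinS k D′ S′
  WinS-⇔ k D≗ S≗ = mk⇔ (WinS-resp k D≗ S≗) (WinS-resp k (sym ∘ D≗) (sym ∘ S≗))

  WinD-suc : ∀ {k D S} → WinD k D S → WinD (suc k) D S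
  WinS-suc : ∀ {k D S} → WinS k D S → WinS (suc k) D S
  WinD-suc {zero}  dom        = inj₁ dom
  WinD-suc {suc k} (inj₁ dom) = inj₁ dom
  WinD-suc {suc k} (inj₂ (¬won , v , unplayed , win)) = inj₂ (¬won , v , unplayed , WinS-suc win)
  WinS-suc (inj₁ dom)          = inj₁ dom
  WinS-suc (inj₂ (¬won , win)) = inj₂ (¬won , λ w unplayed → WinD-suc (win w unplayed))

  WinD-mono : ∀ {j k D S} → j ≤′ k → WinD j D S → WinD k D S
  WinD-mono ≤′-refl        win = win
  WinD-mono (≤′-step j≤′k) win = WinD-suc (WinD-mono j≤′k win)

  WinS-mono : ∀ {j k D S} → j ≤′ k → WinS j D S → WinS k D S
  WinS-mono ≤′-refl        win = win
  WinS-mono (≤′-step j≤′k) win = WinS-suc (WinS-mono j≤′k win)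

  γMB-intro : ∀ {k} → WinD (suc k) ∅ ∅ → ¬ WinD k ∅ ∅ → IsγMB G (suc k)
  γMB-intro win ¬win = win , λ j j<1+k → ¬win ∘ WinD-mono (≤⇒≤′ (s≤s⁻¹ j<1+k))

  γ′MB-intro : ∀ {k} → WinS (suc k) ∅ ∅ → ¬ WinS k ∅ ∅ → IsγMB' G (suc k)
  γ′MB-intro win ¬win = win , λ j j<1+k → ¬win ∘ WinS-mono (≤⇒≤′ (s≤s⁻¹ j<1+k))

  inClosedNbhd? : ∀ u v → Dec (InClosedNbhd u v)
  inClosedNbhd? u v = (u ≟ v) ⊎-dec (adj v u ≟ᵇ true)

  module Decide (vertices : List V) (∈-vertices : ∀ v → v ∈ vertices)
                (N : V → List V)
                (N-sound : ∀ {u v} → u ∈ N v → InClosedNbhd u v)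
                (N-complete : ∀ {u v} → InClosedNbhd u v → u ∈ N v)
                (_==_ : V → V → Bool) (==-agrees : ∀ u v → u == v ≡ does (u ≟ v)) where
    open Search vertices ∈-vertices

    -- Insertion through a cheap Boolean test instead of the graph's decidable equality on pairs,
    -- which is slow to normalise.
    _⊕_ : VSet → V → VSet
    (A ⊕ v) u = if u == v then true else A u

    ⊕≗＋ : ∀ A v → A ⊕ v ≗ A ＋ v
    ⊕≗＋ A v u = cong (if_then true else A u) (==-agrees u v)

    dominating? : ∀ D → Dec (Dominating D)
    dominating? D = map′ (λ dom v → let u , u∈N , Du = find (dom v) in u , Du , N-sound u∈N)
                         (λ dom v → let u , Du , u~v = dom v in lose (N-complete u~v) Du)
                         (all? λ v → Any.any? (λ u → D u ≟ᵇ true) (N v))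

    stallerWon? : ∀ S → Dec (StallerWon S)
    stallerWon? S = map′ (λ (v , claimed) → v , λ u u~v → All.lookup claimed (N-complete u~v))
                         (λ (v , claimed) → v , All.tabulate λ u∈N → claimed _ (N-sound u∈N))
                         (any? λ v → All.all? (λ u → S u ≟ᵇ true) (N v))

    unplayed? : ∀ D S v → Dec (Unplayed D S v)
    unplayed? D S v = (D v ≟ᵇ false) ×-dec (S v ≟ᵇ false)

    -- The search is a Boolean program with a separate correctness proof: recursing on Dec values
    -- instead keeps each evaluated subtree alive through the proof component of its parent.
    winDᵇ winSᵇ : ℕ → VSet → VSet → Bool
    winDᵇ zero    D S = does (dominating? D)
    winDᵇ (suc k) D S = does (dominating? D) ∨ (not (does (stallerWon? S)) ∧
      any (λ v → does (unplayed? D S v) ∧ winSᵇ k (D ⊕ v) S) vertices)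
    winSᵇ k D S = does (dominating? D) ∨ (not (does (stallerWon? S)) ∧
      all (λ w → not (does (unplayed? D S w)) ∨ winDᵇ k D (S ⊕ w)) vertices)

    winD-reflects : ∀ k D S → Reflects (WinD k D S) (winDᵇ k D S)
    winS-reflects : ∀ k D S → Reflects (WinS k D S) (winSᵇ k D S)
    winD-reflects zero    D S = proof (dominating? D)
    winD-reflects (suc k) D S = proof (dominating? D) ⊎-reflects
      ¬-reflects (proof (stallerWon? S)) ×-reflects any-reflects λ v →
        proof (unplayed? D S v) ×-reflects
          reflects-⇔ (WinS-⇔ k (⊕≗＋ D v) λ _ → refl) (winS-reflects k (D ⊕ v) S)
    winS-reflects k D S = proof (dominating? D) ⊎-reflects
      ¬-reflects (proof (stallerWon? S)) ×-reflects all-reflects λ w →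
        proof (unplayed? D S w) →-reflects
          reflects-⇔ (WinD-⇔ k (λ _ → refl) (⊕≗＋ S w)) (winD-reflects k D (S ⊕ w))

    winD? : ∀ k D S → Dec (WinD k D S)
    winD? k D S = winDᵇ k D S because winD-reflects k D S

    winS? : ∀ k D S → Dec (WinS k D S)
    winS? k D S = winSᵇ k D S because winS-reflects k D S

open MakerBreaker (P 3 □ P 3)
open Graph (P 3 □ P 3) using (V; _≟_)

vertices₃ : List V
vertices₃ = cartesianProduct (allFin 3) (allFin 3)

∈-vertices₃ : ∀ v → v ∈ vertices₃
∈-vertices₃ (i , j) = ∈-cartesianProduct⁺ (∈-allFin i) (∈-allFin j)

open Search vertices₃ ∈-vertices₃
open import Data.List.Membership.DecPropositional _≟_ using (_∈?_)

N₃ : V → List V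
N₃ (i , j) = (i , j) ∷ map (i ,_) (nbr j) ++ map (_, j) (nbr i)
  where
  nbr : Fin 3 → List (Fin 3)
  nbr zero             = suc zero ∷ []
  nbr (suc zero)       = zero ∷ suc (suc zero) ∷ []
  nbr (suc (suc zero)) = suc zero ∷ []

N₃-sound : ∀ {u v} → u ∈ N₃ v → InClosedNbhd u v
N₃-sound {u} {v} = from-yes (all? λ v → all? λ u → u ∈? N₃ v →-dec inClosedNbhd? u v) v u

N₃-complete : ∀ {u v} → InClosedNbhd u v → u ∈ N₃ v
N₃-complete {u} {v} = from-yes (all? λ v → all? λ u → inClosedNbhd? u v →-dec u ∈? N₃ v) v u

_==₃_ : V → V → Bool
(a , b) ==₃ (c , d) = (toℕ a ≡ᵇ toℕ c) ∧ (toℕ b ≡ᵇ toℕ d)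

==₃-agrees : ∀ u v → u ==₃ v ≡ does (u ≟ v)
==₃-agrees u v = from-yes (all? λ u → all? λ v → u ==₃ v ≟ᵇ does (u ≟ v)) u v

open Decide vertices₃ ∈-vertices₃ N₃ N₃-sound N₃-complete _==₃_ ==₃-agrees

proposition3p3 : IsγMB (P 3 □ P 3) 4 × IsγMB' (P 3 □ P 3) 4
proposition3p3 = γMB-intro  (from-yes (winD? 4 ∅ ∅)) (from-no (winD? 3 ∅ ∅))
               , γ′MB-intro (from-yes (winS? 4 ∅ ∅)) (from-no (winS? 3 ∅ ∅))
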